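{- Let $q=p^s$, let $m\ge1$ and $2\le n\le q$ be integers, and let $1\le t<q$. Suppose $f_{m,t}(r_1,\dots,r_{n-1},0)$ is not the zero polynomial. If an $(n-1)$-element subset $\{b_1,\dots,b_{n-1}\}$ of $\mathbb{F}_q^*$ is chosen uniformly at random, then $$\Pr[f_{m,t}(b_1,\dots,b_{n-1},0)=0]\le\frac{t(q-1)^{n-2}}{(q-1)(q-2)\cdots(q-n+1)}.$$
   Context: The polynomials $f_{m,t}(r_1,\dots,r_n)$: let $M$ be the multiset of $mn$ variables in which each of $r_1,\dots,r_n$ appears $m$ times, and let $e_j$ be the $j$-th elementary symmetric polynomial of $M$ ($e_0=1$, $e_j=0$ for $j>mn$). Define $f_{m,0}=1$ and $f_{m,t}=-\sum_{j=1}^{t}e_j f_{m,t-j}$ for $t\ge1$, with integer coefficients reduced mod $p$, viewed in $\mathbb{F}_q[r_1,\dots,r_n]$. (These are symmetric polynomials.) -}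

module Defs where

open import Level using (Level; _⊔_; Lift) renaming (suc to lsuc)
open import Algebra.Bundles using (CommutativeRing)
open import Data.Nat using (ℕ; zero; suc; _∸_)
open import Data.Fin using (Fin) renaming (zero to fzero; suc to fsuc)
open import Data.List using (List; []; _∷_; map; foldr; zipWith; upTo; length; filter; replicate; concatMap; _++_; allFin)
open import Data.List.Relation.Unary.All using (All)
open import Data.List.Relation.Unary.Any using (Any)
open import Data.List.Relation.Unary.AllPairs using (AllPairs)
open import Data.Vec using (Vec; lookup) renaming ([] to []ᵥ; _∷_ to _∷ᵥ_)
open import Data.Product using (∃)
open import Relation.Nullary using (¬_)
open import Relation.Nullary.Decidable using (¬?)
open import Relation.Binary.Definitions using (Decidable)

record FiniteField (c ℓ : Level) : Set (lsuc (c ⊔ ℓ)) where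
  field
    commRing : CommutativeRing c ℓ
  open CommutativeRing commRing public hiding (ring)
  field
    _≟_      : Decidable _≈_
    0≉1      : ¬ (0# ≈ 1#)
    inverse  : ∀ x → ¬ (x ≈ 0#) → ∃ λ y → (x * y) ≈ 1#
    elements : List Carrier
    complete : ∀ x → Any (x ≈_) elements
    distinct : AllPairs (λ x y → ¬ (x ≈ y)) elements

  card : ℕ
  card = length elements

  nonzeroElements : List Carrier
  nonzeroElements = filter (λ x → ¬? (x ≟ 0#)) elements

-- The k-element sublists of a list (the k-subsets of a duplicate-free
-- list, each listed exactly once).

combinations : ∀ {a} {A : Set a} (k : ℕ) → List A → List (Vec A k)
combinations zero    _        = []ᵥ ∷ []
combinations (suc k) []       = []
combinations (suc k) (x ∷ xs) =
  map (x ∷ᵥ_) (combinations k xs) ++ combinations (suc k) xs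

-- Generic ring operations, used to run the defining recursion of f_{m,t}
-- in any commutative ring (in particular in the polynomial ring).

record RingOps {a} (A : Set a) : Set a where
  field
    zer one : A
    add mul : A → A → A
    neg     : A → A

module Recursion {a} {A : Set a} (O : RingOps A) where
  open RingOps O

  esym : List A → ℕ → A
  esym []       zero    = one
  esym []       (suc j) = zer
  esym (x ∷ xs) zero    = one
  esym (x ∷ xs) (suc j) = add (esym xs (suc j)) (mul x (esym xs j))

  -- fList M t = [ f_t , f_{t-1} , … , f_0 ] for the multiset M
  fList : List A → ℕ → List A
  fList M zero    = one ∷ []
  fList M (suc t) =
    neg (foldr add zer
          (zipWith mul (map (λ j → esym M (suc j)) (upTo (suc t))) (fList M t)))
    ∷ fList M t

  headOr : List A → A
  headOr []      = zer
  headOr (x ∷ _) = x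

  -- f_{m,t}(x_1,…,x_n): the multiset has each x_i repeated m times
  f : ℕ → ℕ → List A → A
  f m t xs = headOr (fList (concatMap (replicate m) xs) t)

-- Multivariate polynomials over a commutative ring, dense representation:
-- Poly 0 = coefficients, Poly (k+1) = lists of coefficients in Poly k
-- (coefficient list in the first variable, lowest degree first).

module Polynomials {c ℓ} (R : CommutativeRing c ℓ) where
  open CommutativeRing R

  Poly : ℕ → Set c
  Poly zero    = Carrier
  Poly (suc k) = List (Poly k)

  zeroP : ∀ k → Poly k
  zeroP zero    = 0#
  zeroP (suc k) = []

  constP : ∀ k → Carrier → Poly k
  constP zero    a = a
  constP (suc k) a = constP k a ∷ []

  addP : ∀ k → Poly k → Poly k → Poly k
  addP zero    a        b        = a + b
  addP (suc k) []       ys       = ys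
  addP (suc k) (x ∷ xs) []       = x ∷ xs
  addP (suc k) (x ∷ xs) (y ∷ ys) = addP k x y ∷ addP (suc k) xs ys

  negP : ∀ k → Poly k → Poly k
  negP zero    a  = - a
  negP (suc k) xs = map (negP k) xs

  mulP : ∀ k → Poly k → Poly k → Poly k
  mulP zero    a        b  = a * b
  mulP (suc k) []       ys = []
  mulP (suc k) (x ∷ xs) ys =
    addP (suc k) (map (mulP k x) ys) (zeroP k ∷ mulP (suc k) xs ys)

  -- the variable r_{i+1}
  var : ∀ k → Fin k → Poly k
  var (suc k) fzero    = zeroP k ∷ constP k 1# ∷ []
  var (suc k) (fsuc i) = var k i ∷ []

  polyOps : ∀ k → RingOps (Poly k)
  polyOps k = record
    { zer = zeroP k ; one = constP k 1# ; add = addP k ; mul = mulP k ; neg = negP k }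

  IsZeroPoly : ∀ k → Poly k → Set (c ⊔ ℓ)
  IsZeroPoly zero    a  = Lift c (a ≈ 0#)
  IsZeroPoly (suc k) xs = All (IsZeroPoly k) xs

  evalP : ∀ k → Poly k → (Fin k → Carrier) → Carrier
  evalP zero    a  ρ = a
  evalP (suc k) xs ρ = foldr (λ a acc → evalP k a (λ i → ρ (fsuc i)) + ρ fzero * acc) 0# xs

  vars : ∀ k → List (Poly k)
  vars k = map (var k) (allFin k)

module _ {c ℓ} (F : FiniteField c ℓ) where
  open FiniteField F
  open Polynomials commRing

  fPolyLastZero : (m t n : ℕ) → Poly (n ∸ 1)
  fPolyLastZero m t n =
    Recursion.f (polyOps (n ∸ 1)) m t (vars (n ∸ 1) ++ zeroP (n ∸ 1) ∷ [])

  subsetsOfUnits : (n : ℕ) → List (Vec Carrier (n ∸ 1))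
  subsetsOfUnits n = combinations (n ∸ 1) nonzeroElements

  zeroCount : (m t n : ℕ) → ℕ
  zeroCount m t n =
    length (filter (λ bs → evalP (n ∸ 1) (fPolyLastZero m t n) (lookup bs) ≟ 0#)
                   (subsetsOfUnits n))

module Submission where

-- Every (n-1)-subset of F_q^* is the underlying set of (n-1)! tuples in (F_q^*)^(n-1), and
-- f_{m,t}(r_1,…,r_{n-1},0) is symmetric, so (n-1)! times the number of bad subsets is at
-- most the number of its zeros in (F_q^*)^(n-1).  Since e_j has degree j and the recursion
-- makes f_{m,t} isobaric of weight t in the e_j, the polynomial (nonzero by hypothesis) has
-- total degree at most t, and the Schwartz–Zippel lemma over S = F_q^* bounds its zeros by
-- t (q-1)^(n-2).  Multiplying by (q-1 choose n-1) and using
-- (q-1)_(n-1) = (n-1)! (q-1 choose n-1) gives the claim.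

open import Defs
open import Algebra.Bundles using (CommutativeRing)

module Counting where
  open import Data.Nat using (ℕ; zero; suc; _+_; _*_; _^_; _≤_; z≤n; _!; _≤?_)
  open import Data.Nat.Properties
  open import Data.Nat.Combinatorics using (_C_; _P_; nCk+nC[k+1]≡[n+1]C[k+1]; nCk≡nPk/k!)
  open import Data.Nat.Combinatorics.Base using (_P′_)
  open import Data.Nat.Combinatorics.Specification using (k>n⇒nPk≡0; k>n⇒nCk≡0; nPk≡n!/[n∸k]!; nP′k≡n!/[n∸k]!; k!∣nP′k)
  open import Data.Nat.Divisibility using (_∣_)
  open import Data.Nat.DivMod using (m*[n/m]≡n)
  open import Data.Nat.Solver using (module +-*-Solver)
  open import Data.List using (List; []; _∷_; _++_; map; length)
  open import Data.List.Properties using (length-++; length-map)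
  open import Data.List.Relation.Unary.All using (All; []; _∷_)
  open import Data.List.Relation.Binary.Permutation.Propositional using (_↭_; ↭-refl; prep; swap)
  open import Data.Vec using (Vec; toList) renaming ([] to []ᵥ; _∷_ to _∷ᵥ_)
  open import Function using (_∘_)
  open import Level using (Level)
  open import Relation.Binary.PropositionalEquality
  open import Relation.Nullary using (yes; no)

  open +-*-Solver using (solve; _:+_; _:*_; _:=_; con)

  private
    variable
      a b : Level
      A : Set a
      B : Set b

  ∑ : List B → (B → ℕ) → ℕ
  ∑ []       f = 0
  ∑ (x ∷ xs) f = f x + ∑ xs f

  ∑-cong : ∀ (S : List B) {f g : B → ℕ} → (∀ x → f x ≡ g x) → ∑ S f ≡ ∑ S g
  ∑-cong []      f≡g = refl
  ∑-cong (x ∷ S) f≡g = cong₂ _+_ (f≡g x) (∑-cong S f≡g)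

  ∑-mono : ∀ (S : List B) {f g : B → ℕ} → (∀ x → f x ≤ g x) → ∑ S f ≤ ∑ S g
  ∑-mono []      f≤g = z≤n
  ∑-mono (x ∷ S) f≤g = +-mono-≤ (f≤g x) (∑-mono S f≤g)

  ∑-mono-All : ∀ {q} {Q : B → Set q} (S : List B) {f g : B → ℕ} →
               All Q S → (∀ {x} → Q x → f x ≤ g x) → ∑ S f ≤ ∑ S g
  ∑-mono-All []      []         f≤g = z≤n
  ∑-mono-All (x ∷ S) (px ∷ pxs) f≤g = +-mono-≤ (f≤g px) (∑-mono-All S pxs f≤g)

  ∑-+ : ∀ (S : List B) (f g : B → ℕ) → ∑ S (λ x → f x + g x) ≡ ∑ S f + ∑ S g
  ∑-+ []      f g = refl
  ∑-+ (x ∷ S) f g = trans (cong (f x + g x +_) (∑-+ S f g))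
    (solve 4 (λ a b c d → (a :+ b) :+ (c :+ d) := (a :+ c) :+ (b :+ d)) refl (f x) (g x) (∑ S f) (∑ S g))

  ∑-* : ∀ (S : List B) c (f : B → ℕ) → ∑ S (λ x → c * f x) ≡ c * ∑ S f
  ∑-* []      c f = sym (*-zeroʳ c)
  ∑-* (x ∷ S) c f = trans (cong (c * f x +_) (∑-* S c f)) (sym (*-distribˡ-+ c (f x) (∑ S f)))

  ∑-const : ∀ (S : List B) c → ∑ S (λ _ → c) ≡ c * length S
  ∑-const []      c = sym (*-zeroʳ c)
  ∑-const (x ∷ S) c = trans (cong (c +_) (∑-const S c)) (sym (*-suc c (length S)))

  ∑-++ : ∀ (xs ys : List B) f → ∑ (xs ++ ys) f ≡ ∑ xs f + ∑ ys f
  ∑-++ []       ys f = refl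
  ∑-++ (x ∷ xs) ys f = trans (cong (f x +_) (∑-++ xs ys f)) (sym (+-assoc (f x) _ _))

  ∑-map : ∀ (g : A → B) (xs : List A) f → ∑ (map g xs) f ≡ ∑ xs (f ∘ g)
  ∑-map g []       f = refl
  ∑-map g (x ∷ xs) f = cong (f (g x) +_) (∑-map g xs f)

  ∑-comm : ∀ (S : List A) (T : List B) (f : A → B → ℕ) →
           ∑ S (λ x → ∑ T (f x)) ≡ ∑ T (λ y → ∑ S (λ x → f x y))
  ∑-comm []      T f = sym (∑-const T 0)
  ∑-comm (x ∷ S) T f = trans (cong (∑ T (f x) +_) (∑-comm S T f))
    (sym (∑-+ T (f x) (λ y → ∑ S (λ x′ → f x′ y))))

  ∑ⁿ : ∀ k → List A → (Vec A k → ℕ) → ℕ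
  ∑ⁿ zero    S g = g []ᵥ
  ∑ⁿ (suc k) S g = ∑ S (λ x → ∑ⁿ k S (g ∘ (x ∷ᵥ_)))

  module _ {A : Set a} where

    ∑ⁿ-cong : ∀ k S {g h : Vec A k → ℕ} → (∀ v → g v ≡ h v) → ∑ⁿ k S g ≡ ∑ⁿ k S h
    ∑ⁿ-cong zero    S g≡h = g≡h []ᵥ
    ∑ⁿ-cong (suc k) S g≡h = ∑-cong S (λ x → ∑ⁿ-cong k S (λ v → g≡h (x ∷ᵥ v)))

    ∑ⁿ-mono : ∀ k S {g h : Vec A k → ℕ} → (∀ v → g v ≤ h v) → ∑ⁿ k S g ≤ ∑ⁿ k S h
    ∑ⁿ-mono zero    S g≤h = g≤h []ᵥ
    ∑ⁿ-mono (suc k) S g≤h = ∑-mono S (λ x → ∑ⁿ-mono k S (λ v → g≤h (x ∷ᵥ v)))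

    ∑ⁿ-+ : ∀ k S (g h : Vec A k → ℕ) → ∑ⁿ k S (λ v → g v + h v) ≡ ∑ⁿ k S g + ∑ⁿ k S h
    ∑ⁿ-+ zero    S g h = refl
    ∑ⁿ-+ (suc k) S g h = trans (∑-cong S (λ x → ∑ⁿ-+ k S _ _)) (∑-+ S _ _)

    ∑ⁿ-* : ∀ k S c (g : Vec A k → ℕ) → ∑ⁿ k S (λ v → c * g v) ≡ c * ∑ⁿ k S g
    ∑ⁿ-* zero    S c g = refl
    ∑ⁿ-* (suc k) S c g = trans (∑-cong S (λ x → ∑ⁿ-* k S c _)) (∑-* S c _)

    ∑ⁿ-const : ∀ k (S : List A) c → ∑ⁿ k S (λ _ → c) ≡ c * length S ^ k
    ∑ⁿ-const zero    S c = sym (*-identityʳ c)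
    ∑ⁿ-const (suc k) S c = trans (∑-cong S (λ x → ∑ⁿ-const k S c))
      (trans (∑-const S (c * length S ^ k))
        (solve 3 (λ c l p → (c :* p) :* l := c :* (l :* p)) refl c (length S) (length S ^ k)))

    ∑-∑ⁿ-comm : ∀ k (S : List B) T (f : B → Vec A k → ℕ) →
                ∑ S (λ x → ∑ⁿ k T (f x)) ≡ ∑ⁿ k T (λ v → ∑ S (λ x → f x v))
    ∑-∑ⁿ-comm zero    S T f = refl
    ∑-∑ⁿ-comm (suc k) S T f = trans (∑-comm S T (λ x y → ∑ⁿ k T (f x ∘ (y ∷ᵥ_))))
      (∑-cong T (λ y → ∑-∑ⁿ-comm k S T (λ x → f x ∘ (y ∷ᵥ_))))

    ∑ⁿ-suc-inner : ∀ k S (g : Vec A (suc k) → ℕ) →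
                   ∑ⁿ (suc k) S g ≡ ∑ⁿ k S (λ v → ∑ S (λ x → g (x ∷ᵥ v)))
    ∑ⁿ-suc-inner k S g = ∑-∑ⁿ-comm k S S (λ x → g ∘ (x ∷ᵥ_))

    ∑ⁿ-∷-≤ : ∀ k x xs (g : Vec A k → ℕ) → ∑ⁿ k xs g ≤ ∑ⁿ k (x ∷ xs) g
    ∑ⁿ-∷-≤ zero    x xs g = ≤-refl
    ∑ⁿ-∷-≤ (suc k) x xs g = ≤-trans (∑-mono xs (λ y → ∑ⁿ-∷-≤ k x xs (g ∘ (y ∷ᵥ_)))) (m≤n+m _ _)

    Symmetric : ∀ {k} → (Vec A k → ℕ) → Set a
    Symmetric g = ∀ {v w} → toList v ↭ toList w → g v ≡ g w

    -- Among the tuples over x ∷ xs are those with entries in xs, and the suc k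
    -- ways of placing a single x among entries from xs.
    ∑ⁿ-∷-≥ : ∀ k x xs (g : Vec A (suc k) → ℕ) → Symmetric g →
             ∑ⁿ (suc k) xs g + suc k * ∑ⁿ k xs (g ∘ (x ∷ᵥ_)) ≤ ∑ⁿ (suc k) (x ∷ xs) g
    ∑ⁿ-∷-≥ zero    x xs g g-sym =
      ≤-reflexive (trans (+-comm Σ₁ _) (cong (_+ Σ₁) (+-identityʳ (g (x ∷ᵥ []ᵥ)))))
      where Σ₁ = ∑ xs (λ y → g (y ∷ᵥ []ᵥ))
    ∑ⁿ-∷-≥ (suc k) x xs g g-sym = begin
        Σ₂ + suc (suc k) * Σₓ
          ≡⟨ solve 3 (λ a b k → b :+ (con 1 :+ (con 1 :+ k)) :* a := a :+ (b :+ (con 1 :+ k) :* a)) refl Σₓ Σ₂ k ⟩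
        Σₓ + (Σ₂ + suc k * Σₓ)
          ≡⟨ cong (λ z → Σₓ + (Σ₂ + suc k * z)) xy≡yx ⟨
        Σₓ + (Σ₂ + suc k * ∑ xs (λ y → ∑ⁿ k xs (g ∘ (y ∷ᵥ_) ∘ (x ∷ᵥ_))))
          ≡⟨ cong (λ z → Σₓ + (Σ₂ + z)) (∑-* xs (suc k) _) ⟨
        Σₓ + (Σ₂ + ∑ xs (λ y → suc k * ∑ⁿ k xs (g ∘ (y ∷ᵥ_) ∘ (x ∷ᵥ_))))
          ≡⟨ cong (Σₓ +_) (∑-+ xs _ _) ⟨
        Σₓ + ∑ xs (λ y → ∑ⁿ (suc k) xs (g ∘ (y ∷ᵥ_)) + suc k * ∑ⁿ k xs (g ∘ (y ∷ᵥ_) ∘ (x ∷ᵥ_)))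
          ≤⟨ +-mono-≤ (∑ⁿ-∷-≤ (suc k) x xs (g ∘ (x ∷ᵥ_)))
                      (∑-mono xs (λ y → ∑ⁿ-∷-≥ k x xs (g ∘ (y ∷ᵥ_)) (g-sym ∘ prep y))) ⟩
        ∑ⁿ (suc k) (x ∷ xs) (g ∘ (x ∷ᵥ_)) + ∑ xs (λ y → ∑ⁿ (suc k) (x ∷ xs) (g ∘ (y ∷ᵥ_)))
      ∎
      where
      open ≤-Reasoning
      Σₓ = ∑ⁿ (suc k) xs (g ∘ (x ∷ᵥ_))
      Σ₂ = ∑ⁿ (suc (suc k)) xs g
      xy≡yx : ∑ xs (λ y → ∑ⁿ k xs (g ∘ (y ∷ᵥ_) ∘ (x ∷ᵥ_))) ≡ Σₓ
      xy≡yx = ∑-cong xs (λ y → ∑ⁿ-cong k xs (λ w → g-sym (swap y x ↭-refl)))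

    k!*∑-combinations≤∑ⁿ : ∀ k S (g : Vec A k → ℕ) → Symmetric g →
                           k ! * ∑ (combinations k S) g ≤ ∑ⁿ k S g
    k!*∑-combinations≤∑ⁿ zero    S        g g-sym = ≤-reflexive (trans (+-identityʳ _) (+-identityʳ _))
    k!*∑-combinations≤∑ⁿ (suc k) []       g g-sym = ≤-reflexive (*-zeroʳ (suc k !))
    k!*∑-combinations≤∑ⁿ (suc k) (x ∷ xs) g g-sym = begin
        suc k ! * ∑ (map (x ∷ᵥ_) (combinations k xs) ++ combinations (suc k) xs) g
          ≡⟨ cong (suc k ! *_) (trans (∑-++ (map (x ∷ᵥ_) (combinations k xs)) _ g)
                                      (cong (_+ Σ₂) (∑-map (x ∷ᵥ_) (combinations k xs) g))) ⟩
        suc k ! * (Σₓ + Σ₂)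
          ≡⟨ solve 4 (λ k f a b → ((con 1 :+ k) :* f) :* (a :+ b) := ((con 1 :+ k) :* f) :* b :+ (con 1 :+ k) :* (f :* a))
                     refl k (k !) Σₓ Σ₂ ⟩
        suc k ! * Σ₂ + suc k * (k ! * Σₓ)
          ≤⟨ +-mono-≤ (k!*∑-combinations≤∑ⁿ (suc k) xs g g-sym)
                      (*-monoʳ-≤ (suc k) (k!*∑-combinations≤∑ⁿ k xs (g ∘ (x ∷ᵥ_)) (g-sym ∘ prep x))) ⟩
        ∑ⁿ (suc k) xs g + suc k * ∑ⁿ k xs (g ∘ (x ∷ᵥ_))
          ≤⟨ ∑ⁿ-∷-≥ k x xs g g-sym ⟩
        ∑ⁿ (suc k) (x ∷ xs) g
      ∎
      where
      open ≤-Reasoning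
      Σₓ = ∑ (combinations k xs) (g ∘ (x ∷ᵥ_))
      Σ₂ = ∑ (combinations (suc k) xs) g

  length-combinations : ∀ k (xs : List A) → length (combinations k xs) ≡ length xs C k
  length-combinations zero    xs       = refl
  length-combinations (suc k) []       = refl
  length-combinations (suc k) (x ∷ xs) = begin
    length (map (x ∷ᵥ_) (combinations k xs) ++ combinations (suc k) xs)
      ≡⟨ length-++ (map (x ∷ᵥ_) (combinations k xs)) ⟩
    length (map (x ∷ᵥ_) (combinations k xs)) + length (combinations (suc k) xs)
      ≡⟨ cong₂ _+_ (trans (length-map _ (combinations k xs)) (length-combinations k xs))
                   (length-combinations (suc k) xs) ⟩
    length xs C k + length xs C suc k
      ≡⟨ nCk+nC[k+1]≡[n+1]C[k+1] (length xs) k ⟩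
    suc (length xs) C suc k
    ∎
    where open ≡-Reasoning

  nPk≡k!*nCk : ∀ n k → n P k ≡ k ! * (n C k)
  nPk≡k!*nCk n k with k ≤? n
  ... | no k≰n = begin
    n P k         ≡⟨ k>n⇒nPk≡0 (≰⇒> k≰n) ⟩
    0             ≡⟨ *-zeroʳ (k !) ⟨
    k ! * 0       ≡⟨ cong (k ! *_) (k>n⇒nCk≡0 (≰⇒> k≰n)) ⟨
    k ! * (n C k) ∎
    where open ≡-Reasoning
  ... | yes k≤n = begin
    n P k                           ≡⟨ m*[n/m]≡n {{_!≢0 k}} k!∣nPk ⟨
    k ! * ((n P k) / k !) {{_!≢0 k}} ≡⟨ cong (k ! *_) (nCk≡nPk/k! k≤n) ⟨
    k ! * (n C k)                     ∎
    where
    open ≡-Reasoning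
    open import Data.Nat using (_/_)
    k!∣nPk : k ! ∣ n P k
    k!∣nPk = subst (k ! ∣_) (trans (nP′k≡n!/[n∸k]! k≤n) (sym (nPk≡n!/[n∸k]! k≤n))) (k!∣nP′k k≤n)

open Counting

module RecursionSimulation where
  open import Data.Nat using (zero; suc)
  open import Data.List using ([]; _∷_; map; upTo; zipWith)
  open import Data.List.Relation.Binary.Pointwise as Pointwise using (Pointwise; []; _∷_)
  open import Level using (Level; _⊔_)

  module _ {a b r : Level} {A : Set a} {B : Set b} where

    record Simulation (O₁ : RingOps A) (O₂ : RingOps B) (_∼_ : A → B → Set r) : Set (a ⊔ b ⊔ r) where
      private
        module O₁ = RingOps O₁
        module O₂ = RingOps O₂
      field
        zer-∼ : O₁.zer ∼ O₂.zer
        one-∼ : O₁.one ∼ O₂.one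
        add-∼ : ∀ {x y u v} → x ∼ u → y ∼ v → O₁.add x y ∼ O₂.add u v
        mul-∼ : ∀ {x y u v} → x ∼ u → y ∼ v → O₁.mul x y ∼ O₂.mul u v
        neg-∼ : ∀ {x u} → x ∼ u → O₁.neg x ∼ O₂.neg u

    module _ {O₁ : RingOps A} {O₂ : RingOps B} {_∼_ : A → B → Set r} (sim : Simulation O₁ O₂ _∼_) where
      open Simulation sim
      private
        module R₁ = Recursion O₁
        module R₂ = Recursion O₂

      esym-∼ : ∀ {M N} → Pointwise _∼_ M N → ∀ j → R₁.esym M j ∼ R₂.esym N j
      esym-∼ []            zero    = one-∼
      esym-∼ []            (suc j) = zer-∼
      esym-∼ (x∼y ∷ M∼N) zero    = one-∼
      esym-∼ (x∼y ∷ M∼N) (suc j) = add-∼ (esym-∼ M∼N (suc j)) (mul-∼ x∼y (esym-∼ M∼N j))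

      zipWith-mul-∼ : ∀ {xs ys us vs} → Pointwise _∼_ xs us → Pointwise _∼_ ys vs →
                      Pointwise _∼_ (zipWith (RingOps.mul O₁) xs ys) (zipWith (RingOps.mul O₂) us vs)
      zipWith-mul-∼ []          _           = []
      zipWith-mul-∼ (_ ∷ _)     []          = []
      zipWith-mul-∼ (x∼u ∷ xs∼us) (y∼v ∷ ys∼vs) = mul-∼ x∼u y∼v ∷ zipWith-mul-∼ xs∼us ys∼vs

      fList-∼ : ∀ {M N} → (∀ j → R₁.esym M j ∼ R₂.esym N j) → ∀ t → Pointwise _∼_ (R₁.fList M t) (R₂.fList N t)
      fList-∼         e zero    = one-∼ ∷ []
      fList-∼ {M} {N} e (suc t) =
        neg-∼ (Pointwise.foldr⁺ add-∼ zer-∼ (zipWith-mul-∼ esyms (fList-∼ {M} {N} e t))) ∷ fList-∼ {M} {N} e t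
        where
        esyms : Pointwise _∼_ (map (λ j → R₁.esym M (suc j)) (upTo (suc t))) (map (λ j → R₂.esym N (suc j)) (upTo (suc t)))
        esyms = Pointwise.map⁺ (λ j → R₁.esym M (suc j)) (λ j → R₂.esym N (suc j)) (Pointwise.refl (λ {j} → e (suc j)))

      headOr-∼ : ∀ {L K} → Pointwise _∼_ L K → R₁.headOr L ∼ R₂.headOr K
      headOr-∼ []        = zer-∼
      headOr-∼ (x∼y ∷ _) = x∼y

      f-∼ : ∀ m t {xs ys} → Pointwise _∼_ xs ys → R₁.f m t xs ∼ R₂.f m t ys
      f-∼ m t xs∼ys = headOr-∼ (fList-∼ (esym-∼ repeated) t)
        where
        repeated = Pointwise.concat⁺ (Pointwise.map⁺ _ _ (Pointwise.map (λ x∼y → Pointwise.replicate⁺ x∼y m) xs∼ys))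

open RecursionSimulation

module PolynomialProperties {c ℓ} (R : CommutativeRing c ℓ) where
  open import Data.Fin using (Fin) renaming (zero to fzero; suc to fsuc)
  open import Data.List using (List; []; _∷_; _++_; map; foldr; zipWith; applyUpTo; concatMap; replicate)
  open import Function using (id; _∘_)
  open import Data.List.Relation.Unary.All as All using (All; []; _∷_)
  import Data.List.Relation.Unary.All.Properties as All
  open import Data.List.Relation.Binary.Permutation.Propositional using (_↭_; prep; swap)
  import Data.List.Relation.Binary.Permutation.Propositional as ↭
  import Data.List.Relation.Binary.Permutation.Propositional.Properties as ↭
  open import Data.Nat as ℕ using (ℕ; zero; suc; pred; z≤n)
  import Data.Nat.Properties as ℕ
  open import Data.Product using (_×_; _,_)
  open import Data.Unit using (⊤; tt)
  open import Level using (Lift; lift; _⊔_)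
  import Relation.Binary.PropositionalEquality as ≡

  open CommutativeRing R hiding (zero)
  open Polynomials R
  open import Algebra.Properties.Ring ring using (-0#≈0#; -‿+-comm; -‿distribʳ-*)
  open import Algebra.Solver.Ring.NaturalCoefficients.Default commutativeSemiring using (solve; _:+_; _:*_; _:=_; con)

  ringOps : RingOps Carrier
  ringOps = record { zer = 0# ; one = 1# ; add = _+_ ; mul = _*_ ; neg = -_ }

  evalP-zeroP : ∀ k ρ → evalP k (zeroP k) ρ ≈ 0#
  evalP-zeroP zero    ρ = refl
  evalP-zeroP (suc k) ρ = refl

  evalP-constP : ∀ k a ρ → evalP k (constP k a) ρ ≈ a
  evalP-constP zero    a ρ = refl
  evalP-constP (suc k) a ρ = trans (+-cong (evalP-constP k a _) (zeroʳ _)) (+-identityʳ a)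

  evalP-addP : ∀ k p q ρ → evalP k (addP k p q) ρ ≈ evalP k p ρ + evalP k q ρ
  evalP-addP zero    p        q        ρ = refl
  evalP-addP (suc k) []       ys       ρ = sym (+-identityˡ _)
  evalP-addP (suc k) (x ∷ xs) []       ρ = sym (+-identityʳ _)
  evalP-addP (suc k) (x ∷ xs) (y ∷ ys) ρ =
    trans (+-cong (evalP-addP k x y _) (*-congˡ (evalP-addP (suc k) xs ys ρ)))
      (solve 5 (λ a b r u v → (a :+ b) :+ r :* (u :+ v) := (a :+ r :* u) :+ (b :+ r :* v)) refl
        (evalP k x _) (evalP k y _) (ρ fzero) (evalP (suc k) xs ρ) (evalP (suc k) ys ρ))

  evalP-negP : ∀ k p ρ → evalP k (negP k p) ρ ≈ - evalP k p ρ
  evalP-negP zero    p        ρ = refl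
  evalP-negP (suc k) []       ρ = sym -0#≈0#
  evalP-negP (suc k) (x ∷ xs) ρ =
    trans (+-cong (evalP-negP k x _) (trans (*-congˡ (evalP-negP (suc k) xs ρ)) (sym (-‿distribʳ-* _ _))))
      (-‿+-comm _ _)

  mutual
    evalP-mulP : ∀ k p q ρ → evalP k (mulP k p q) ρ ≈ evalP k p ρ * evalP k q ρ
    evalP-mulP zero    p        q  ρ = refl
    evalP-mulP (suc k) []       ys ρ = sym (zeroˡ _)
    evalP-mulP (suc k) (x ∷ xs) ys ρ =
      trans (evalP-addP (suc k) (map (mulP k x) ys) (zeroP k ∷ mulP (suc k) xs ys) ρ)
        (trans (+-cong (evalP-scale k x ys ρ) (+-cong (evalP-zeroP k _) (*-congˡ (evalP-mulP (suc k) xs ys ρ))))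
          (solve 4 (λ a r u v → a :* v :+ (con 0 :+ r :* (u :* v)) := (a :+ r :* u) :* v) refl
            (evalP k x _) (ρ fzero) (evalP (suc k) xs ρ) (evalP (suc k) ys ρ)))

    evalP-scale : ∀ k x ys ρ →
                  evalP (suc k) (map (mulP k x) ys) ρ ≈ evalP k x (λ i → ρ (fsuc i)) * evalP (suc k) ys ρ
    evalP-scale k x []       ρ = sym (zeroʳ _)
    evalP-scale k x (y ∷ ys) ρ =
      trans (+-cong (evalP-mulP k x y _) (*-congˡ (evalP-scale k x ys ρ)))
        (solve 4 (λ a b r v → a :* b :+ r :* (a :* v) := a :* (b :+ r :* v)) refl
          (evalP k x _) (evalP k y _) (ρ fzero) (evalP (suc k) ys ρ))

  evalP-var : ∀ k i ρ → evalP k (var k i) ρ ≈ ρ i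
  evalP-var (suc k) fzero    ρ =
    trans (+-cong (evalP-zeroP k _) (*-congˡ (trans (+-cong (evalP-constP k 1# _) (zeroʳ _)) (+-identityʳ _))))
      (trans (+-identityˡ _) (*-identityʳ _))
  evalP-var (suc k) (fsuc i) ρ = trans (+-cong (evalP-var k i _) (zeroʳ _)) (+-identityʳ _)

  eval₁ : Poly 1 → Carrier → Carrier
  eval₁ u b = evalP 1 u (λ _ → b)

  evalP-suc : ∀ k P (ρ : Fin (suc k) → Carrier) →
              evalP (suc k) P ρ ≡.≡ eval₁ (map (λ p → evalP k p (ρ ∘ fsuc)) P) (ρ fzero)
  evalP-suc k []      ρ = ≡.refl
  evalP-suc k (p ∷ P) ρ = ≡.cong (λ z → evalP k p (ρ ∘ fsuc) + ρ fzero * z) (evalP-suc k P ρ)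

  IsZeroPoly⇒evalP≈0 : ∀ k p ρ → IsZeroPoly k p → evalP k p ρ ≈ 0#
  IsZeroPoly⇒evalP≈0 zero    p        ρ (lift p≈0) = p≈0
  IsZeroPoly⇒evalP≈0 (suc k) []       ρ []         = refl
  IsZeroPoly⇒evalP≈0 (suc k) (x ∷ xs) ρ (x≈0 ∷ xs≈0) =
    trans (+-cong (IsZeroPoly⇒evalP≈0 k x _ x≈0)
                  (trans (*-congˡ (IsZeroPoly⇒evalP≈0 (suc k) xs ρ xs≈0)) (zeroʳ _)))
          (+-identityʳ 0#)

  evalP-simulation : ∀ k ρ → Simulation (polyOps k) ringOps (λ p x → evalP k p ρ ≈ x)
  evalP-simulation k ρ = record
    { zer-∼ = evalP-zeroP k ρ
    ; one-∼ = evalP-constP k 1# ρ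
    ; add-∼ = λ p≈x q≈y → trans (evalP-addP k _ _ ρ) (+-cong p≈x q≈y)
    ; mul-∼ = λ p≈x q≈y → trans (evalP-mulP k _ _ ρ) (*-cong p≈x q≈y)
    ; neg-∼ = λ p≈x → trans (evalP-negP k _ ρ) (-‿cong p≈x)
    }

  -- Total degree below B; DegreeBelow k 0 p forces p to vanish.
  DegreeBelow : ∀ k → ℕ → Poly k → Set (c ⊔ ℓ)
  DegreeBelow zero    zero    a        = Lift c (a ≈ 0#)
  DegreeBelow zero    (suc B) a        = Lift (c ⊔ ℓ) ⊤
  DegreeBelow (suc k) B       []       = Lift (c ⊔ ℓ) ⊤
  DegreeBelow (suc k) B       (x ∷ xs) = DegreeBelow k B x × DegreeBelow (suc k) (pred B) xs

  DegreeBelow-suc : ∀ k {B} p → DegreeBelow k B p → DegreeBelow k (suc B) p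
  DegreeBelow-suc zero    {zero}  a        _          = lift tt
  DegreeBelow-suc zero    {suc B} a        _          = lift tt
  DegreeBelow-suc (suc k)         []       _          = lift tt
  DegreeBelow-suc (suc k) {zero}  (x ∷ xs) (dx , dxs) = DegreeBelow-suc k x dx , dxs
  DegreeBelow-suc (suc k) {suc B} (x ∷ xs) (dx , dxs) = DegreeBelow-suc k x dx , DegreeBelow-suc (suc k) xs dxs

  DegreeBelow-mono : ∀ {k B B′ p} → B ℕ.≤ B′ → DegreeBelow k B p → DegreeBelow k B′ p
  DegreeBelow-mono {k} {p = p} B≤B′ dp = go (ℕ.≤⇒≤′ B≤B′)
    where
    go : ∀ {B′} → _ ℕ.≤′ B′ → DegreeBelow k B′ p
    go ℕ.≤′-refl     = dp
    go (ℕ.≤′-step q) = DegreeBelow-suc k p (go q)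

  DegreeBelow-zeroP : ∀ k B → DegreeBelow k B (zeroP k)
  DegreeBelow-zeroP zero    zero    = lift refl
  DegreeBelow-zeroP zero    (suc B) = lift tt
  DegreeBelow-zeroP (suc k) B       = lift tt

  DegreeBelow-constP : ∀ k a → DegreeBelow k 1 (constP k a)
  DegreeBelow-constP zero    a = lift tt
  DegreeBelow-constP (suc k) a = DegreeBelow-constP k a , lift tt

  DegreeBelow-var : ∀ k i → DegreeBelow k 2 (var k i)
  DegreeBelow-var (suc k) fzero    = DegreeBelow-zeroP k 2 , DegreeBelow-constP k 1# , lift tt
  DegreeBelow-var (suc k) (fsuc i) = DegreeBelow-var k i , lift tt

  DegreeBelow-addP : ∀ k {B} p q → DegreeBelow k B p → DegreeBelow k B q → DegreeBelow k B (addP k p q)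
  DegreeBelow-addP zero    {zero}  a        b        (lift a≈0) (lift b≈0) = lift (trans (+-cong a≈0 b≈0) (+-identityʳ 0#))
  DegreeBelow-addP zero    {suc B} a        b        _          _          = lift tt
  DegreeBelow-addP (suc k)         []       ys       _          dys        = dys
  DegreeBelow-addP (suc k)         (x ∷ xs) []       dxs        _          = dxs
  DegreeBelow-addP (suc k)         (x ∷ xs) (y ∷ ys) (dx , dxs) (dy , dys) =
    DegreeBelow-addP k x y dx dy , DegreeBelow-addP (suc k) xs ys dxs dys

  DegreeBelow-negP : ∀ k {B} p → DegreeBelow k B p → DegreeBelow k B (negP k p)
  DegreeBelow-negP zero    {zero}  a        (lift a≈0) = lift (trans (-‿cong a≈0) -0#≈0#)
  DegreeBelow-negP zero    {suc B} a        _          = lift tt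
  DegreeBelow-negP (suc k)         []       _          = lift tt
  DegreeBelow-negP (suc k)         (x ∷ xs) (dx , dxs) = DegreeBelow-negP k x dx , DegreeBelow-negP (suc k) xs dxs

  DegreeBelow-sum : ∀ k {B} ps → All (DegreeBelow k B) ps → DegreeBelow k B (foldr (addP k) (zeroP k) ps)
  DegreeBelow-sum k {B} []       []         = DegreeBelow-zeroP k B
  DegreeBelow-sum k     (p ∷ ps) (dp ∷ dps) = DegreeBelow-addP k p _ dp (DegreeBelow-sum k ps dps)

  -- deg p < a and deg q < b give deg (p q) < a + b - 1, and p q = 0 when a or b is 0.
  mulBound : ℕ → ℕ → ℕ
  mulBound zero    _       = zero
  mulBound (suc a) zero    = zero
  mulBound (suc a) (suc b) = suc (a ℕ.+ b)

  mulBound-predʳ : ∀ a b → mulBound a (pred b) ℕ.≤ pred (mulBound a b)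
  mulBound-predʳ zero    b             = z≤n
  mulBound-predʳ (suc a) zero          = z≤n
  mulBound-predʳ (suc a) (suc zero)    = z≤n
  mulBound-predʳ (suc a) (suc (suc b)) = ℕ.≤-reflexive (≡.sym (ℕ.+-suc a b))

  mulBound-predˡ : ∀ a b → mulBound (pred a) b ℕ.≤ pred (mulBound a b)
  mulBound-predˡ zero          b       = z≤n
  mulBound-predˡ (suc zero)    b       = z≤n
  mulBound-predˡ (suc (suc a)) zero    = z≤n
  mulBound-predˡ (suc (suc a)) (suc b) = ℕ.≤-refl

  mutual
    DegreeBelow-mulP : ∀ k {a b} p q → DegreeBelow k a p → DegreeBelow k b q → DegreeBelow k (mulBound a b) (mulP k p q)
    DegreeBelow-mulP zero    {zero}          p        q  (lift p≈0) _          = lift (trans (*-congʳ p≈0) (zeroˡ q))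
    DegreeBelow-mulP zero    {suc a} {zero}  p        q  _          (lift q≈0) = lift (trans (*-congˡ q≈0) (zeroʳ p))
    DegreeBelow-mulP zero    {suc a} {suc b} p        q  _          _          = lift tt
    DegreeBelow-mulP (suc k)                 []       ys _          _          = lift tt
    DegreeBelow-mulP (suc k) {a}     {b}     (x ∷ xs) ys (dx , dxs) dys        =
      DegreeBelow-addP (suc k) (map (mulP k x) ys) (zeroP k ∷ mulP (suc k) xs ys)
        (DegreeBelow-scale k x ys dx dys)
        (DegreeBelow-zeroP k _ , DegreeBelow-mono (mulBound-predˡ a b) (DegreeBelow-mulP (suc k) xs ys dxs dys))

    DegreeBelow-scale : ∀ k {a b} x ys → DegreeBelow k a x → DegreeBelow (suc k) b ys →
                        DegreeBelow (suc k) (mulBound a b) (map (mulP k x) ys)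
    DegreeBelow-scale k         x []       _  _          = lift tt
    DegreeBelow-scale k {a} {b} x (y ∷ ys) dx (dy , dys) =
      DegreeBelow-mulP k x y dx dy , DegreeBelow-mono (mulBound-predʳ a b) (DegreeBelow-scale k x ys dx dys)

  DegreeBelow-0⇒IsZeroPoly : ∀ k p → DegreeBelow k 0 p → IsZeroPoly k p
  DegreeBelow-0⇒IsZeroPoly zero    p        dp         = dp
  DegreeBelow-0⇒IsZeroPoly (suc k) []       _          = []
  DegreeBelow-0⇒IsZeroPoly (suc k) (x ∷ xs) (dx , dxs) =
    DegreeBelow-0⇒IsZeroPoly k x dx ∷ DegreeBelow-0⇒IsZeroPoly (suc k) xs dxs

  module _ (k : ℕ) where
    open Recursion (polyOps k)

    esym-degree : ∀ {M} → All (DegreeBelow k 2) M → ∀ j → DegreeBelow k (suc j) (esym M j)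
    esym-degree {[]}    []        zero    = DegreeBelow-constP k 1#
    esym-degree {[]}    []        (suc j) = DegreeBelow-zeroP k _
    esym-degree {x ∷ M} (dx ∷ dM) zero    = DegreeBelow-constP k 1#
    esym-degree {x ∷ M} (dx ∷ dM) (suc j) =
      DegreeBelow-addP k (esym M (suc j)) _ (esym-degree dM (suc j)) (DegreeBelow-mulP k x _ dx (esym-degree dM j))

    DegreesRising : ℕ → List (Poly k) → Set (c ⊔ ℓ)
    DegreesRising a []       = Lift (c ⊔ ℓ) ⊤
    DegreesRising a (e ∷ es) = DegreeBelow k a e × DegreesRising (suc a) es

    DegreesFalling : ℕ → List (Poly k) → Set (c ⊔ ℓ)
    DegreesFalling B []       = Lift (c ⊔ ℓ) ⊤
    DegreesFalling B (y ∷ ys) = DegreeBelow k B y × DegreesFalling (pred B) ys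

    esyms-rising : ∀ {M} → All (DegreeBelow k 2) M → ∀ g n a → (∀ i → 2 ℕ.+ g i ℕ.≤ a ℕ.+ i) →
                   DegreesRising a (map (λ j → esym M (suc j)) (applyUpTo g n))
    esyms-rising dM g zero    a g≤ = lift tt
    esyms-rising dM g (suc n) a g≤ =
      DegreeBelow-mono (≡.subst (2 ℕ.+ g 0 ℕ.≤_) (ℕ.+-identityʳ a) (g≤ 0)) (esym-degree dM (suc (g 0))) ,
      esyms-rising dM (g ∘ suc) n (suc a) (λ i → ≡.subst (2 ℕ.+ g (suc i) ℕ.≤_) (ℕ.+-suc a i) (g≤ (suc i)))

    zipWith-mulP-vanishing : ∀ {a es L} → DegreesRising (suc a) es → DegreesFalling 0 L →
                             All (DegreeBelow k 0) (zipWith (mulP k) es L)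
    zipWith-mulP-vanishing {es = []}             _          _         = []
    zipWith-mulP-vanishing {es = e ∷ es} {[]}    _          _         = []
    zipWith-mulP-vanishing {es = e ∷ es} {y ∷ L} (de , des) (dy , dL) =
      DegreeBelow-mulP k e y de dy ∷ zipWith-mulP-vanishing des dL

    zipWith-mulP-degree : ∀ {a B es L} → DegreesRising (suc a) es → DegreesFalling (suc B) L →
                          All (DegreeBelow k (suc (a ℕ.+ B))) (zipWith (mulP k) es L)
    zipWith-mulP-degree {es = []}                    _          _         = []
    zipWith-mulP-degree {es = e ∷ es} {[]}           _          _         = []
    zipWith-mulP-degree {a} {zero}  {e ∷ es} {y ∷ L} (de , des) (dy , dL) =
      DegreeBelow-mulP k e y de dy ∷ All.map (DegreeBelow-mono z≤n) (zipWith-mulP-vanishing des dL)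
    zipWith-mulP-degree {a} {suc B} {e ∷ es} {y ∷ L} (de , des) (dy , dL) =
      DegreeBelow-mulP k e y de dy ∷
      All.map (DegreeBelow-mono (ℕ.≤-reflexive (≡.cong suc (≡.sym (ℕ.+-suc a B))))) (zipWith-mulP-degree des dL)

    fList-degree : ∀ {M} → All (DegreeBelow k 2) M → ∀ t → DegreesFalling (suc t) (fList M t)
    fList-degree dM zero    = DegreeBelow-constP k 1# , lift tt
    fList-degree dM (suc t) =
      DegreeBelow-negP k _ (DegreeBelow-sum k _ (zipWith-mulP-degree esyms (fList-degree dM t))) ,
      fList-degree dM t
      where esyms = esyms-rising dM id (suc t) 2 (λ i → ℕ.≤-refl)

    headOr-degree : ∀ {B L} → DegreesFalling B L → DegreeBelow k B (headOr L)
    headOr-degree {L = []}    _        = DegreeBelow-zeroP k _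
    headOr-degree {L = _ ∷ _} (dy , _) = dy

    f-degree : ∀ m t {xs} → All (DegreeBelow k 2) xs → DegreeBelow k (suc t) (f m t xs)
    f-degree m t dxs = headOr-degree (fList-degree (All.concat⁺ (All.map⁺ (All.map (All.replicate⁺ m) dxs))) t)

  concatMap-replicate-↭ : ∀ {a} {A : Set a} m {xs ys : List A} →
                          xs ↭ ys → concatMap (replicate m) xs ↭ concatMap (replicate m) ys
  concatMap-replicate-↭ m ↭.refl          = ↭.refl
  concatMap-replicate-↭ m (prep x p)      = ↭.++⁺ˡ (replicate m x) (concatMap-replicate-↭ m p)
  concatMap-replicate-↭ m (swap x y p)    = ↭.trans (↭.shifts (replicate m x) (replicate m y))
    (↭.++⁺ˡ (replicate m y) (↭.++⁺ˡ (replicate m x) (concatMap-replicate-↭ m p)))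
  concatMap-replicate-↭ m (↭.trans p q)   = ↭.trans (concatMap-replicate-↭ m p) (concatMap-replicate-↭ m q)

  ≈-simulation : Simulation ringOps ringOps _≈_
  ≈-simulation = record { zer-∼ = refl ; one-∼ = refl ; add-∼ = +-cong ; mul-∼ = *-cong ; neg-∼ = -‿cong }

  module _ where
    open Recursion ringOps

    esym-∷ : ∀ x {xs ys} → (∀ j → esym xs j ≈ esym ys j) → ∀ j → esym (x ∷ xs) j ≈ esym (x ∷ ys) j
    esym-∷ x e zero    = refl
    esym-∷ x e (suc j) = +-cong (e (suc j)) (*-congˡ (e j))

    esym-swap : ∀ x y xs j → esym (x ∷ y ∷ xs) j ≈ esym (y ∷ x ∷ xs) j
    esym-swap x y xs zero          = refl
    esym-swap x y xs (suc zero)    = begin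
      (esym xs 1 + y * esym xs 0) + x * 1# ≈⟨ +-congʳ (+-congˡ (*-congˡ (esym-zero xs))) ⟩
      (esym xs 1 + y * 1#) + x * 1#        ≈⟨ solve 3 (λ e x y → (e :+ y :* con 1) :+ x :* con 1 := (e :+ x :* con 1) :+ y :* con 1) refl (esym xs 1) x y ⟩
      (esym xs 1 + x * 1#) + y * 1#        ≈⟨ +-congʳ (+-congˡ (*-congˡ (esym-zero xs))) ⟨
      (esym xs 1 + x * esym xs 0) + y * 1# ∎
      where
      open import Relation.Binary.Reasoning.Setoid setoid
      esym-zero : ∀ xs → esym xs 0 ≈ 1#
      esym-zero []      = refl
      esym-zero (_ ∷ _) = refl
    esym-swap x y xs (suc (suc j)) =
      solve 5 (λ a b d x y → (a :+ y :* b) :+ x :* (b :+ y :* d) := (a :+ x :* b) :+ y :* (b :+ x :* d)) refl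
        (esym xs (suc (suc j))) (esym xs (suc j)) (esym xs j) x y

    esym-↭ : ∀ {xs ys} → xs ↭ ys → ∀ j → esym xs j ≈ esym ys j
    esym-↭ ↭.refl         j = refl
    esym-↭ (prep x p)     j = esym-∷ x (esym-↭ p) j
    esym-↭ (swap x y p)   j = trans (esym-swap x y _ j) (esym-∷ y (esym-∷ x (esym-↭ p)) j)
    esym-↭ (↭.trans p q)  j = trans (esym-↭ p j) (esym-↭ q j)

    f-↭ : ∀ m t {xs ys} → xs ↭ ys → f m t xs ≈ f m t ys
    f-↭ m t p = headOr-∼ ≈-simulation (fList-∼ ≈-simulation (esym-↭ (concatMap-replicate-↭ m p)) t)

module FieldRoots {c ℓ} (F : FiniteField c ℓ) where
  open import Data.Bool using (if_then_else_)
  open import Data.Empty using (⊥-elim)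
  open import Data.List using ([]; _∷_)
  open import Data.List.Relation.Unary.All using ([]; _∷_)
  open import Data.List.Relation.Unary.AllPairs using (AllPairs; []; _∷_)
  open import Data.Nat as ℕ using (ℕ; zero; suc; z≤n; s≤s)
  import Data.Nat.Properties as ℕ
  open import Data.Product using (_,_)
  open import Function using (_∘_)
  open import Level using (lift)
  open import Data.Unit using (tt)
  open import Relation.Nullary using (¬_; yes; no; does)
  import Relation.Binary.PropositionalEquality as ≡
  open ≡ using (_≡_)

  open FiniteField F hiding (zero)
  open Polynomials commRing
  open PolynomialProperties commRing
  open import Algebra.Solver.Ring.NaturalCoefficients.Default commutativeSemiring using (solve; _:+_; _:*_; _:=_; con)
  open import Algebra.Properties.Ring (CommutativeRing.ring commRing) using (-‿distribˡ-*)
  open import Relation.Binary.Reasoning.Setoid setoid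

  zeroIndicator : Carrier → ℕ
  zeroIndicator x = if does (x ≟ 0#) then 1 else 0

  zeroIndicator-cong : ∀ {x y} → x ≈ y → zeroIndicator x ≡ zeroIndicator y
  zeroIndicator-cong {x} {y} x≈y with x ≟ 0# | y ≟ 0#
  ... | yes _   | yes _   = ≡.refl
  ... | yes x≈0 | no y≉0  = ⊥-elim (y≉0 (trans (sym x≈y) x≈0))
  ... | no x≉0  | yes y≈0 = ⊥-elim (x≉0 (trans x≈y y≈0))
  ... | no _    | no _    = ≡.refl

  zeroIndicator≤1 : ∀ x → zeroIndicator x ℕ.≤ 1
  zeroIndicator≤1 x with x ≟ 0#
  ... | yes _ = ℕ.≤-refl
  ... | no _  = z≤n

  zeroIndicator-mono : ∀ {x y} → (x ≈ 0# → y ≈ 0#) → zeroIndicator x ℕ.≤ zeroIndicator y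
  zeroIndicator-mono {x} {y} x≈0⇒y≈0 with x ≟ 0# | y ≟ 0#
  ... | no _    | _       = z≤n
  ... | yes _   | yes _   = ℕ.≤-refl
  ... | yes x≈0 | no y≉0  = ⊥-elim (y≉0 (x≈0⇒y≈0 x≈0))

  x*z≈y*z⇒x≉y⇒z≈0 : ∀ x y z → x * z ≈ y * z → ¬ x ≈ y → z ≈ 0#
  x*z≈y*z⇒x≉y⇒z≈0 x y z xz≈yz x≉y with inverse (x - y) (x≉y ∘ x-y≈0⇒x≈y)
    where
    x-y≈0⇒x≈y : x - y ≈ 0# → x ≈ y
    x-y≈0⇒x≈y x-y≈0 = begin
      x             ≈⟨ +-identityʳ x ⟨
      x + 0#        ≈⟨ +-congˡ (-‿inverseˡ y) ⟨
      x + (- y + y) ≈⟨ +-assoc x (- y) y ⟨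
      (x - y) + y   ≈⟨ +-congʳ x-y≈0 ⟩
      0# + y        ≈⟨ +-identityˡ y ⟩
      y             ∎
  ... | w , [x-y]w≈1 = begin
    z                        ≈⟨ *-identityˡ z ⟨
    1# * z                   ≈⟨ *-congʳ [x-y]w≈1 ⟨
    ((x - y) * w) * z        ≈⟨ solve 4 (λ x y w z → ((x :+ y) :* w) :* z := w :* (x :* z :+ y :* z)) refl x (- y) w z ⟩
    w * (x * z + (- y) * z)  ≈⟨ *-congˡ (+-cong xz≈yz (sym (-‿distribˡ-* y z))) ⟩
    w * (y * z - y * z)      ≈⟨ *-congˡ (-‿inverseʳ (y * z)) ⟩
    w * 0#                   ≈⟨ zeroʳ w ⟩
    0#                       ∎

  -- Synthetic division by r - a; the remainder is eval₁ u a.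
  quotient : Carrier → Poly 1 → Poly 1
  quotient a []      = []
  quotient a (_ ∷ u) = eval₁ u a ∷ quotient a u

  -- u(b) = (b - a) q(b) + u(a), arranged without subtraction.
  division-identity : ∀ a u b → eval₁ u b + a * eval₁ (quotient a u) b ≈ b * eval₁ (quotient a u) b + eval₁ u a
  division-identity a []      b = solve 2 (λ a b → con 0 :+ a :* con 0 := b :* con 0 :+ con 0) refl a b
  division-identity a (c ∷ u) b = begin
    (c + b * uᵇ) + a * (uᵃ + b * qᵇ) ≈⟨ solve 6 (λ c u a r b q → (c :+ b :* u) :+ a :* (r :+ b :* q) := (c :+ a :* r) :+ b :* (u :+ a :* q))
                                              refl c uᵇ a uᵃ b qᵇ ⟩
    (c + a * uᵃ) + b * (uᵇ + a * qᵇ) ≈⟨ +-congˡ (*-congˡ (division-identity a u b)) ⟩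
    (c + a * uᵃ) + b * (b * qᵇ + uᵃ) ≈⟨ +-comm _ _ ⟩
    b * (b * qᵇ + uᵃ) + (c + a * uᵃ) ≈⟨ +-congʳ (*-congˡ (+-comm _ _)) ⟩
    b * (uᵃ + b * qᵇ) + (c + a * uᵃ) ∎
    where
    uᵃ = eval₁ u a
    uᵇ = eval₁ u b
    qᵇ = eval₁ (quotient a u) b

  quotient-IsZeroPoly : ∀ a u → eval₁ u a ≈ 0# → IsZeroPoly 1 (quotient a u) → IsZeroPoly 1 u
  quotient-IsZeroPoly a []      _    _                   = []
  quotient-IsZeroPoly a (c ∷ u) ua≈0 (lift u′a≈0 ∷ q≈0) =
    lift c≈0 ∷ quotient-IsZeroPoly a u u′a≈0 q≈0
    where
    c≈0 : c ≈ 0#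
    c≈0 = begin
      c                  ≈⟨ +-identityʳ c ⟨
      c + 0#             ≈⟨ +-congˡ (zeroʳ a) ⟨
      c + a * 0#         ≈⟨ +-congˡ (*-congˡ u′a≈0) ⟨
      c + a * eval₁ u a  ≈⟨ ua≈0 ⟩
      0#                 ∎

  quotient-degree : ∀ a B u → DegreeBelow 1 (suc B) u → DegreeBelow 1 B (quotient a u)
  quotient-degree a B       []      _         = lift tt
  quotient-degree a zero    (c ∷ u) (_ , du) =
    lift (IsZeroPoly⇒evalP≈0 1 u (λ _ → a) (DegreeBelow-0⇒IsZeroPoly 1 u du)) ,
    quotient-degree a zero u (DegreeBelow-suc 1 u du)
  quotient-degree a (suc B) (c ∷ u) (_ , du) = lift tt , quotient-degree a B u du

  ∑-roots≤degree : ∀ S d u → AllPairs (λ x y → ¬ x ≈ y) S → DegreeBelow 1 (suc d) u → ¬ IsZeroPoly 1 u →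
                   ∑ S (zeroIndicator ∘ eval₁ u) ℕ.≤ d
  ∑-roots≤degree []      d u _                  _  _   = z≤n
  ∑-roots≤degree (a ∷ S) d u (a∉S ∷ S-distinct) du u≢0 with eval₁ u a ≟ 0#
  ... | no _ = ∑-roots≤degree S d u S-distinct du u≢0
  ... | yes ua≈0 with d
  ...   | zero  = ⊥-elim (u≢0 (quotient-IsZeroPoly a u ua≈0 (DegreeBelow-0⇒IsZeroPoly 1 _ (quotient-degree a 0 u du))))
  ...   | suc d = s≤s (ℕ.≤-trans (∑-mono-All S a∉S roots-of-quotient)
                                  (∑-roots≤degree S d (quotient a u) S-distinct (quotient-degree a (suc d) u du) q≢0))
    where
    q≢0 : ¬ IsZeroPoly 1 (quotient a u)
    q≢0 = u≢0 ∘ quotient-IsZeroPoly a u ua≈0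
    roots-of-quotient : ∀ {b} → ¬ a ≈ b → zeroIndicator (eval₁ u b) ℕ.≤ zeroIndicator (eval₁ (quotient a u) b)
    roots-of-quotient {b} a≉b = zeroIndicator-mono λ ub≈0 → x*z≈y*z⇒x≉y⇒z≈0 a b _ (begin
      a * qᵇ                   ≈⟨ +-identityˡ _ ⟨
      0# + a * qᵇ              ≈⟨ +-congʳ ub≈0 ⟨
      eval₁ u b + a * qᵇ       ≈⟨ division-identity a u b ⟩
      b * qᵇ + eval₁ u a       ≈⟨ +-congˡ ua≈0 ⟩
      b * qᵇ + 0#              ≈⟨ +-identityʳ _ ⟩
      b * qᵇ                   ∎) a≉b
      where qᵇ = eval₁ (quotient a u) b

module SchwartzZippel {c ℓ} (F : FiniteField c ℓ) where
  open import Data.Empty using (⊥-elim)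
  open import Data.Fin using (Fin)
  open import Data.List using (List; []; _∷_; _++_; map; length)
  open import Data.List.Relation.Unary.All using (All; []; _∷_; all?)
  open import Data.List.Relation.Unary.AllPairs using (AllPairs)
  open import Data.Nat using (ℕ; zero; suc; _+_; _*_; _^_; _∸_; _≤_; _<_; z≤n; s≤s)
  open import Data.Nat.Properties hiding (_≟_)
  open import Data.Nat.Solver using (module +-*-Solver)
  open import Data.Product using (_×_; _,_; proj₁; proj₂)
  open import Data.Unit using (tt)
  open import Data.Vec using (Vec; lookup) renaming (_∷_ to _∷ᵥ_)
  open import Function using (_∘_)
  open import Level using (lift; lower; _⊔_)
  open import Relation.Binary.PropositionalEquality
  open import Relation.Nullary using (¬_; Dec; yes; no)
  open import Relation.Nullary.Decidable using (map′)
  open +-*-Solver using (solve; _:+_; _:*_; _:=_)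

  open FiniteField F using (Carrier; _≈_; _≟_; 0#; commRing)
  open Polynomials commRing
  open PolynomialProperties commRing
  open FieldRoots F

  isZeroPoly? : ∀ k p → Dec (IsZeroPoly k p)
  isZeroPoly? zero    p = map′ lift lower (p ≟ 0#)
  isZeroPoly? (suc k) p = all? (isZeroPoly? k) p

  record LeadingCoefficient k (P : Poly (suc k)) : Set (c ⊔ ℓ) where
    field
      below     : List (Poly k)
      leading   : Poly k
      above     : List (Poly k)
      split     : P ≡ below ++ leading ∷ above
      leading≢0 : ¬ IsZeroPoly k leading
      above≡0   : All (IsZeroPoly k) above

  leadingCoefficient : ∀ k P → ¬ IsZeroPoly (suc k) P → LeadingCoefficient k P
  leadingCoefficient k []       P≢0 = ⊥-elim (P≢0 [])
  leadingCoefficient k (x ∷ xs) P≢0 with all? (isZeroPoly? k) xs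
  ... | no xs≢0 = record
    { below = x ∷ below ; leading = leading ; above = above
    ; split = cong (x ∷_) split ; leading≢0 = leading≢0 ; above≡0 = above≡0 }
    where open LeadingCoefficient (leadingCoefficient k xs xs≢0)
  ... | yes xs≡0 with isZeroPoly? k x
  ...   | yes x≡0 = ⊥-elim (P≢0 (x≡0 ∷ xs≡0))
  ...   | no x≢0  = record { below = [] ; leading = x ; above = xs ; split = refl ; leading≢0 = x≢0 ; above≡0 = xs≡0 }

  leading-degree : ∀ k {B} below leading above → ¬ IsZeroPoly k leading →
                   DegreeBelow (suc k) B (below ++ leading ∷ above) →
                   length below < B × DegreeBelow k (B ∸ length below) leading
  leading-degree k {zero}  []      c _ c≢0 (dc , _) = ⊥-elim (c≢0 (DegreeBelow-0⇒IsZeroPoly k c dc))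
  leading-degree k {suc B} []      c _ c≢0 (dc , _) = s≤s z≤n , dc
  leading-degree k {zero}  (_ ∷ b) c a c≢0 (_ , d) with leading-degree k b c a c≢0 d
  ... | () , _
  leading-degree k {suc B} (_ ∷ b) c a c≢0 (_ , d) with leading-degree k b c a c≢0 d
  ... | j<B , dc = s≤s j<B , dc

  module _ (k : ℕ) (ρ : Fin k → Carrier) where
    private
      evalAt : Poly k → Carrier
      evalAt p = evalP k p ρ

    partialEval-degree : ∀ below leading above → All (IsZeroPoly k) above →
                         DegreeBelow 1 (suc (length below)) (map evalAt (below ++ leading ∷ above))
    partialEval-degree []          leading above above≡0 = lift tt , vanishing above above≡0
      where
      vanishing : ∀ ps → All (IsZeroPoly k) ps → DegreeBelow 1 0 (map evalAt ps)
      vanishing []       []           = lift tt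
      vanishing (p ∷ ps) (p≡0 ∷ ps≡0) = lift (IsZeroPoly⇒evalP≈0 k p ρ p≡0) , vanishing ps ps≡0
    partialEval-degree (_ ∷ below) leading above above≡0 = lift tt , partialEval-degree below leading above above≡0

    partialEval-nonzero : ∀ below leading above → ¬ evalAt leading ≈ 0# →
                          ¬ IsZeroPoly 1 (map evalAt (below ++ leading ∷ above))
    partialEval-nonzero []          leading above c≉0 (lift c≈0 ∷ _) = c≉0 c≈0
    partialEval-nonzero (_ ∷ below) leading above c≉0 (_ ∷ rest)     = partialEval-nonzero below leading above c≉0 rest

    -- Where the leading coefficient does not vanish, the restriction to the line has
    -- at most length below roots; elsewhere every point of S may be a root.
    ∑-fibre≤ : ∀ S below leading above → AllPairs (λ x y → ¬ x ≈ y) S → All (IsZeroPoly k) above →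
               ∑ S (zeroIndicator ∘ eval₁ (map evalAt (below ++ leading ∷ above)))
                 ≤ length below + length S * zeroIndicator (evalAt leading)
    ∑-fibre≤ S below leading above S-distinct above≡0 with evalAt leading ≟ 0#
    ... | yes _ = begin
      ∑ S (zeroIndicator ∘ eval₁ u)  ≤⟨ ∑-mono S (λ a → zeroIndicator≤1 _) ⟩
      ∑ S (λ _ → 1)                  ≡⟨ trans (∑-const S 1) (*-identityˡ (length S)) ⟩
      length S                       ≡⟨ *-identityʳ (length S) ⟨
      length S * 1                   ≤⟨ m≤n+m _ (length below) ⟩
      length below + length S * 1    ∎
      where
      open ≤-Reasoning
      u = map evalAt (below ++ leading ∷ above)
    ... | no c≉0 = ≤-trans
      (∑-roots≤degree S _ _ S-distinct (partialEval-degree below leading above above≡0)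
                                       (partialEval-nonzero below leading above c≉0))
      (m≤m+n (length below) _)

  -- Multiplied through by |S| so that the case k = 0 needs no division.
  schwartzZippel : ∀ k S d P → AllPairs (λ x y → ¬ x ≈ y) S → DegreeBelow k (suc d) P → ¬ IsZeroPoly k P →
                   ∑ⁿ k S (λ v → zeroIndicator (evalP k P (lookup v))) * length S ≤ d * length S ^ k
  schwartzZippel zero    S d P _          _  P≢0 with P ≟ 0#
  ... | yes P≈0 = ⊥-elim (P≢0 (lift P≈0))
  ... | no _    = z≤n
  schwartzZippel (suc k) S d P S-distinct dP P≢0 with leadingCoefficient k P P≢0
  ... | record { below = below ; leading = c ; above = above ; split = refl ; leading≢0 = c≢0 ; above≡0 = above≡0 } =
    begin
      ∑ⁿ (suc k) S g * L                                ≡⟨ cong (_* L) (∑ⁿ-suc-inner k S g) ⟩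
      ∑ⁿ k S (λ w → ∑ S (λ a → g (a ∷ᵥ w))) * L         ≤⟨ *-monoˡ-≤ L (∑ⁿ-mono k S fibre) ⟩
      ∑ⁿ k S (λ w → j + L * z w) * L                    ≡⟨ cong (_* L) ∑ⁿ-fibre-bound ⟩
      (j * L ^ k + L * ∑ⁿ k S z) * L                    ≡⟨ solve 4 (λ j p l s → (j :* p :+ l :* s) :* l := j :* (l :* p) :+ l :* (s :* l))
                                                                refl j (L ^ k) L (∑ⁿ k S z) ⟩
      j * (L * L ^ k) + L * (∑ⁿ k S z * L)              ≤⟨ +-monoʳ-≤ (j * (L * L ^ k)) (*-monoʳ-≤ L leading-bound) ⟩
      j * (L * L ^ k) + L * ((d ∸ j) * L ^ k)           ≡⟨ solve 4 (λ j e l p → j :* (l :* p) :+ l :* (e :* p) := (j :+ e) :* (l :* p))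
                                                                refl j (d ∸ j) L (L ^ k) ⟩
      (j + (d ∸ j)) * (L * L ^ k)                       ≡⟨ cong (_* (L * L ^ k)) (m+[n∸m]≡n j≤d) ⟩
      d * (L * L ^ k)                                   ∎
    where
    open ≤-Reasoning
    L = length S
    j = length below
    g : Vec Carrier (suc k) → ℕ
    g v = zeroIndicator (evalP (suc k) (below ++ c ∷ above) (lookup v))
    z : Vec Carrier k → ℕ
    z w = zeroIndicator (evalP k c (lookup w))
    j≤d : j ≤ d
    j≤d = ≤-pred (proj₁ (leading-degree k below c above c≢0 dP))
    leading-bound : ∑ⁿ k S z * L ≤ (d ∸ j) * L ^ k
    leading-bound = schwartzZippel k S (d ∸ j) c S-distinct
      (subst (λ B → DegreeBelow k B c) (+-∸-assoc 1 j≤d) (proj₂ (leading-degree k below c above c≢0 dP))) c≢0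
    fibre : ∀ w → ∑ S (λ a → g (a ∷ᵥ w)) ≤ j + L * z w
    fibre w = subst (_≤ j + L * z w)
      (∑-cong S (λ a → cong zeroIndicator (sym (evalP-suc k (below ++ c ∷ above) (lookup (a ∷ᵥ w))))))
      (∑-fibre≤ k (lookup w) S below c above S-distinct above≡0)
    ∑ⁿ-fibre-bound : ∑ⁿ k S (λ w → j + L * z w) ≡ j * L ^ k + L * ∑ⁿ k S z
    ∑ⁿ-fibre-bound = trans (∑ⁿ-+ k S (λ _ → j) (λ w → L * z w)) (cong₂ _+_ (∑ⁿ-const k S j) (∑ⁿ-* k S L z))

open import Data.Empty using (⊥-elim)
open import Data.Fin as Fin using (Fin)
open import Data.List using ([]; _∷_; _++_; map; filter; length; allFin; tabulate)
open import Data.List.Properties using (filter-all; map-tabulate)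
open import Data.List.Relation.Binary.Pointwise as Pointwise using (Pointwise; _∷_)
import Data.List.Relation.Binary.Permutation.Propositional.Properties as ↭
open import Data.List.Relation.Unary.All as All using (All; _∷_)
import Data.List.Relation.Unary.All.Properties as All
open import Data.List.Relation.Unary.Any using (Any; here; there)
open import Data.List.Relation.Unary.AllPairs using (AllPairs; _∷_)
import Data.List.Relation.Unary.AllPairs.Properties as AllPairs
open import Data.Nat using (ℕ; suc; _*_; _^_; _∸_; _≤_; _<_; z≤n; s≤s; _!; >-nonZero)
open import Data.Nat.Properties using (*-cancelʳ-≤; *-monoˡ-≤; *-comm; *-assoc; ∸-monoˡ-≤; ≤-trans; module ≤-Reasoning)
open import Data.Nat.Combinatorics using (_P_; _C_)
open import Data.Nat.Primality using (Prime)
open import Data.Vec using (Vec; lookup; toList) renaming ([] to []ᵥ; _∷_ to _∷ᵥ_)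
open import Function using (_∘_; id)
open import Relation.Binary.PropositionalEquality
open import Relation.Nullary using (¬_; yes; no)
open import Relation.Nullary.Decidable using (¬?)

map-lookup-allFin : ∀ {a} {A : Set a} {k} (v : Vec A k) → map (lookup v) (allFin k) ≡ toList v
map-lookup-allFin []ᵥ      = refl
map-lookup-allFin (x ∷ᵥ v) = cong (x ∷_) (begin
  map (lookup (x ∷ᵥ v)) (tabulate Fin.suc) ≡⟨ map-tabulate Fin.suc (lookup (x ∷ᵥ v)) ⟩
  tabulate (lookup v)                      ≡⟨ map-tabulate id (lookup v) ⟨
  map (lookup v) (allFin _)                ≡⟨ map-lookup-allFin v ⟩
  toList v                                 ∎)
  where open ≡-Reasoning

module _ {c ℓ} (F : FiniteField c ℓ) where
  open FiniteField F using (Carrier; _≈_; _≟_; 0#; commRing; nonzeroElements)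
  open Polynomials commRing
  open PolynomialProperties commRing
  open FieldRoots F
  open SchwartzZippel F
  private
    module ≈ = FiniteField F
    module Rᶠ = Recursion ringOps

  length-filter≡∑-zeroIndicator : ∀ {b} {B : Set b} (h : B → Carrier) xs →
                                   length (filter (λ x → h x ≟ 0#) xs) ≡ ∑ xs (zeroIndicator ∘ h)
  length-filter≡∑-zeroIndicator h []       = refl
  length-filter≡∑-zeroIndicator h (x ∷ xs) with h x ≟ 0#
  ... | yes _ = cong suc (length-filter≡∑-zeroIndicator h xs)
  ... | no _  = length-filter≡∑-zeroIndicator h xs

  length-filter-≉0 : ∀ xs → AllPairs (λ x y → ¬ x ≈ y) xs → Any (0# ≈_) xs →
                     length (filter (λ x → ¬? (x ≟ 0#)) xs) ≡ length xs ∸ 1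
  length-filter-≉0 (x ∷ xs) (x∉xs ∷ _) _ with x ≟ 0#
  ... | yes x≈0 = cong length (filter-all (λ x → ¬? (x ≟ 0#)) (All.map (λ x≉y y≈0 → x≉y (≈.trans x≈0 (≈.sym y≈0))) x∉xs))
  length-filter-≉0 (x ∷ xs)       _                (here 0≈x)   | no x≉0 = ⊥-elim (x≉0 (≈.sym 0≈x))
  length-filter-≉0 (x ∷ (y ∷ ys)) (_ ∷ ys-distinct) (there 0∈ys) | no _   = cong suc (length-filter-≉0 (y ∷ ys) ys-distinct 0∈ys)

  evalP-fPolyLastZero : ∀ m t k (v : Vec Carrier k) →
                        evalP k (fPolyLastZero F m t (suc k)) (lookup v) ≈ Rᶠ.f m t (toList v ++ 0# ∷ [])
  evalP-fPolyLastZero m t k v = f-∼ (evalP-simulation k (lookup v)) m t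
    (Pointwise.++⁺ (subst (Pointwise _ (vars k)) (map-lookup-allFin v) vars-eval)
                   (evalP-zeroP k (lookup v) ∷ Pointwise.[]))
    where
    vars-eval = Pointwise.map⁺ (var k) (lookup v) (Pointwise.refl (λ {i} → evalP-var k i (lookup v)))

  fPolyLastZero-degree : ∀ m t k → DegreeBelow k (suc t) (fPolyLastZero F m t (suc k))
  fPolyLastZero-degree m t k =
    f-degree k m t (All.++⁺ (All.map⁺ (All.tabulate⁺ (DegreeBelow-var k))) (DegreeBelow-zeroP k 2 ∷ All.[]))

  fPolyLastZero-roots-symmetric : ∀ m t k →
    Symmetric (λ (v : Vec Carrier k) → zeroIndicator (evalP k (fPolyLastZero F m t (suc k)) (lookup v)))
  fPolyLastZero-roots-symmetric m t k {v} {w} v↭w = begin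
    zeroIndicator (evalP k (fPolyLastZero F m t (suc k)) (lookup v)) ≡⟨ zeroIndicator-cong (evalP-fPolyLastZero m t k v) ⟩
    zeroIndicator (Rᶠ.f m t (toList v ++ 0# ∷ []))                 ≡⟨ zeroIndicator-cong (f-↭ m t (↭.++⁺ʳ (0# ∷ []) v↭w)) ⟩
    zeroIndicator (Rᶠ.f m t (toList w ++ 0# ∷ []))                 ≡⟨ zeroIndicator-cong (evalP-fPolyLastZero m t k w) ⟨
    zeroIndicator (evalP k (fPolyLastZero F m t (suc k)) (lookup w)) ∎
    where open ≡-Reasoning

  k!*zeroCount≤ : ∀ m t n → 1 ≤ length nonzeroElements →
                  ¬ IsZeroPoly (suc n) (fPolyLastZero F m t (suc (suc n))) →
                  suc n ! * zeroCount F m t (suc (suc n)) ≤ t * length nonzeroElements ^ n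
  k!*zeroCount≤ m t n 1≤L f≢0 = *-cancelʳ-≤ _ _ L {{>-nonZero 1≤L}} (begin
    suc n ! * zeroCount F m t (suc (suc n)) * L
      ≡⟨ cong (λ z → suc n ! * z * L)
              (length-filter≡∑-zeroIndicator (λ v → evalP (suc n) fPoly (lookup v)) (combinations (suc n) S)) ⟩
    suc n ! * ∑ (combinations (suc n) S) g * L
      ≤⟨ *-monoˡ-≤ L (k!*∑-combinations≤∑ⁿ (suc n) S g (fPolyLastZero-roots-symmetric m t (suc n))) ⟩
    ∑ⁿ (suc n) S g * L
      ≤⟨ schwartzZippel (suc n) S t fPoly (AllPairs.filter⁺ (λ x → ¬? (x ≟ 0#)) (FiniteField.distinct F))
                        (fPolyLastZero-degree m t (suc n)) f≢0 ⟩
    t * (L * L ^ n)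
      ≡⟨ cong (t *_) (*-comm L (L ^ n)) ⟩
    t * (L ^ n * L)
      ≡⟨ *-assoc t (L ^ n) L ⟨
    t * L ^ n * L ∎)
    where
    open ≤-Reasoning
    S = nonzeroElements
    L = length S
    fPoly = fPolyLastZero F m t (suc (suc n))
    g : Vec Carrier (suc n) → ℕ
    g v = zeroIndicator (evalP (suc n) fPoly (lookup v))

  zeroCount*nPk≤ : ∀ m t n → 1 ≤ length nonzeroElements →
                   ¬ IsZeroPoly (suc n) (fPolyLastZero F m t (suc (suc n))) →
                   zeroCount F m t (suc (suc n)) * (length nonzeroElements P suc n)
                     ≤ t * length nonzeroElements ^ n * length (subsetsOfUnits F (suc (suc n)))
  zeroCount*nPk≤ m t n 1≤L f≢0 = begin
    zc * (L P k)                            ≡⟨ cong (zc *_) (nPk≡k!*nCk L k) ⟩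
    zc * (k ! * (L C k))                    ≡⟨ *-assoc zc (k !) _ ⟨
    zc * k ! * (L C k)                      ≡⟨ cong (_* (L C k)) (*-comm zc (k !)) ⟩
    k ! * zc * (L C k)                      ≤⟨ *-monoˡ-≤ (L C k) (k!*zeroCount≤ m t n 1≤L f≢0) ⟩
    t * L ^ n * (L C k)                     ≡⟨ cong (t * L ^ n *_) (length-combinations k nonzeroElements) ⟨
    t * L ^ n * length (combinations k nonzeroElements) ∎
    where
    open ≤-Reasoning
    k = suc n
    L = length nonzeroElements
    zc = zeroCount F m t (suc (suc n))

proposition4p7 : ∀ {c ℓ} (F : FiniteField c ℓ) (p s m n t : ℕ) →
    Prime p → FiniteField.card F ≡ p ^ s →
    1 ≤ m → 2 ≤ n → n ≤ FiniteField.card F → 1 ≤ t → t < FiniteField.card F →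
    ¬ Polynomials.IsZeroPoly (FiniteField.commRing F) (n ∸ 1) (fPolyLastZero F m t n) →
    zeroCount F m t n * ((FiniteField.card F ∸ 1) P (n ∸ 1))
      ≤ t * (FiniteField.card F ∸ 1) ^ (n ∸ 2) * length (subsetsOfUnits F n)
proposition4p7 F p s m (suc (suc n)) t _ _ _ (s≤s (s≤s z≤n)) n≤q _ _ f≢0 =
  subst (λ L → zeroCount F m t (suc (suc n)) * (L P suc n) ≤ t * L ^ n * length (subsetsOfUnits F (suc (suc n))))
        |F*|≡q-1 (zeroCount*nPk≤ F m t n 1≤|F*| f≢0)
  where
  open FiniteField F using (elements; distinct; complete; 0#)
  |F*|≡q-1 = length-filter-≉0 F elements distinct (complete 0#)
  1≤|F*| : 1 ≤ length (FiniteField.nonzeroElements F)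
  1≤|F*| = subst (1 ≤_) (sym |F*|≡q-1) (∸-monoˡ-≤ 1 (≤-trans (s≤s (s≤s z≤n)) n≤q))
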